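{- Let $p$ be an odd prime, $f$ a positive integer, and $d=p^f+1$. Let $K_d=\mathbb{F}_p(\mu_d,u)$, where $\mu_d$ is the set of primitive $d$-th roots of unity and $u^d=t$ for an indeterminate $t$. Let $E$ be the elliptic curve $y^2=x(x+1)(x+t)$. Fix a primitive $d$-th root of unity $\zeta$. Then for each $i\in\{0,1,\ldots,d-1\}$, the point $$P_i^{(d)}=\left(\zeta^i u,\ \zeta^i u\,(\zeta^i u+1)^{d/2}\right)$$ is a $K_d$-rational point of $E$. -}

module Defs where

open import Level using (_⊔_)
open import Algebra.Bundles using (CommutativeRing; Semiring)
open import Data.Nat as ℕ using (ℕ; _<_; _/_)
open import Data.Nat.Primality using (Prime)
open import Data.Product using (∃; _×_)
open import Relation.Nullary using (¬_)
import Algebra.Definitions.RawSemiring as RS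

module _ {c ℓ} (K : CommutativeRing c ℓ) where
  open CommutativeRing K
  open RS (Semiring.rawSemiring semiring) using (_^_) renaming (_×_ to _·_)

  IsField : Set (c ⊔ ℓ)
  IsField = (¬ (1# ≈ 0#)) × (∀ x → ¬ (x ≈ 0#) → ∃ λ y → x * y ≈ 1#)

  HasCharacteristic : ℕ → Set ℓ
  HasCharacteristic p = p · 1# ≈ 0#

  IsPrimitiveRoot : ℕ → Carrier → Set ℓ
  IsPrimitiveRoot d ζ = (ζ ^ d ≈ 1#) × (∀ k → 0 < k → k < d → ¬ (ζ ^ k ≈ 1#))

  OnCurve : Carrier → Carrier → Carrier → Set ℓ
  OnCurve t x y = y ^ 2 ≈ x * ((x + 1#) * (x + t))

  Pₓ : ℕ → Carrier → Carrier → ℕ → Carrier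
  Pₓ d ζ u i = ζ ^ i * u

  Pᵧ : ℕ → Carrier → Carrier → ℕ → Carrier
  Pᵧ d ζ u i = (ζ ^ i * u) * ((ζ ^ i * u + 1#) ^ (d / 2))

  tOf : ℕ → Carrier → Carrier
  tOf d u = u ^ d

-- With q = p^f and X = ζ^i u, the square of the y-coordinate is X²(X+1)^(q+1), the exponent
-- q + 1 being even because p is odd. In characteristic p the Frobenius gives (X+1)^q = X^q + 1,
-- so the square equals X(X+1)(X + X^(q+1)), and X^(q+1) = ζ^(i(q+1)) u^(q+1) = u^(q+1) = t.
module Submission where

open import Defs
open import Algebra.Bundles using (CommutativeRing; CommutativeSemiring)

module PrimeArithmetic where
  open import Data.Nat
  open import Data.Nat.Properties
  open import Data.Nat.Divisibility
  open import Data.Nat.DivMod using (m/n*n≡m)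
  open import Data.Nat.Primality
  open import Data.Nat.Combinatorics using (_C_; nCk≡n!/k![n-k]!; k![n∸k]!∣n!)
  open import Data.Sum using (inj₁; inj₂)
  open import Relation.Nullary using (contradiction)
  open import Relation.Binary.PropositionalEquality

  prime∤m! : ∀ {p m} → Prime p → m < p → p ∤ m !
  prime∤m! {m = zero} p-prime _ p∣1 =
    contradiction (∣1⇒≡1 p∣1) (nonTrivial⇒≢1 {{prime⇒nonTrivial p-prime}})
  prime∤m! {m = suc m} p-prime m<p p∣m! with euclidsLemma (suc m) (m !) p-prime p∣m!
  ... | inj₁ p∣1+m = <⇒≱ m<p (∣⇒≤ p∣1+m)
  ... | inj₂ p∣m!  = prime∤m! p-prime (<-trans (n<1+n m) m<p) p∣m!

  prime∣binomial : ∀ {p k} → Prime p → 0 < k → k < p → p ∣ p C k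
  prime∣binomial {p@(suc p-1)} {k} p-prime 0<k k<p
    with euclidsLemma (p C k) (k ! * (p ∸ k) !) p-prime p∣C*k!*[p∸k]!
    where
    instance _ = k !* (p ∸ k) !≢0
    p∣C*k!*[p∸k]! : p ∣ (p C k) * (k ! * (p ∸ k) !)
    p∣C*k!*[p∸k]! = subst (p ∣_)
      (sym (trans (cong (_* (k ! * (p ∸ k) !)) (nCk≡n!/k![n-k]! (<⇒≤ k<p)))
                  (m/n*n≡m (k![n∸k]!∣n! (<⇒≤ k<p)))))
      (m∣m*n (p-1 !))
  ... | inj₁ p∣C = p∣C
  ... | inj₂ p∣k!*[p∸k]! with euclidsLemma (k !) ((p ∸ k) !) p-prime p∣k!*[p∸k]!
  ...   | inj₁ p∣k!     = contradiction p∣k! (prime∤m! p-prime k<p)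
  ...   | inj₂ p∣[p∸k]! = contradiction p∣[p∸k]! (prime∤m! p-prime (∸-monoʳ-< 0<k (<⇒≤ k<p)))

  odd-prime⇒2∤p^n : ∀ {p} → Prime p → p ≢ 2 → ∀ n → 2 ∤ p ^ n
  odd-prime⇒2∤p^n p-prime p≢2 zero 2∣1 = contradiction (∣1⇒≡1 2∣1) λ ()
  odd-prime⇒2∤p^n {p} p-prime p≢2 (suc n) 2∣p*p^n
    with euclidsLemma p (p ^ n) prime[2] 2∣p*p^n
  ... | inj₂ 2∣p^n = odd-prime⇒2∤p^n p-prime p≢2 n 2∣p^n
  ... | inj₁ 2∣p with prime⇒irreducible p-prime 2∣p
  ...   | inj₁ ()
  ...   | inj₂ 2≡p = p≢2 (sym 2≡p)

  2∤n⇒2∣1+n : ∀ n → 2 ∤ n → 2 ∣ suc n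
  2∤n⇒2∣1+n zero          2∤0   = contradiction (2 ∣0) 2∤0
  2∤n⇒2∣1+n (suc zero)    _     = ∣-refl
  2∤n⇒2∣1+n (suc (suc n)) 2∤2+n =
    ∣m∣n⇒∣m+n ∣-refl (2∤n⇒2∣1+n n (λ 2∣n → 2∤2+n (∣m∣n⇒∣m+n ∣-refl 2∣n)))

  odd-prime⇒2∣p^n+1 : ∀ {p} → Prime p → p ≢ 2 → ∀ n → 2 ∣ p ^ n + 1
  odd-prime⇒2∣p^n+1 {p} p-prime p≢2 n =
    subst (2 ∣_) (+-comm 1 (p ^ n)) (2∤n⇒2∣1+n (p ^ n) (odd-prime⇒2∤p^n p-prime p≢2 n))

module CommutativeSemiringPowers {c ℓ} (S : CommutativeSemiring c ℓ) where
  open import Data.Nat as ℕ using (zero; suc; z<s; s<s)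
  open import Data.Nat.Divisibility using (_∣_; divides)
  open import Data.Nat.Primality using (Prime)
  open import Data.Nat.Combinatorics using (_C_; nCn≡1)
  import Data.Nat.Properties as ℕ using (n∸n≡0; *-comm)
  open import Data.Fin using (Fin; toℕ; inject₁; fromℕ)
  open import Data.Fin.Properties using (toℕ-fromℕ; inject₁ℕ<)
  import Relation.Binary.PropositionalEquality as ≡
  open PrimeArithmetic using (prime∣binomial)

  open CommutativeSemiring S
  open import Algebra.Properties.CommutativeSemiring.Exp S
  open import Algebra.Properties.Semiring.Mult semiring
  open import Algebra.Properties.Semiring.Sum semiring
    using (sum; sum-init-last; sum-cong-≋; sum-replicate-zero)
  open import Algebra.Properties.CommutativeSemiring.Binomial S
    using (binomialTerm; theorem)
  open import Relation.Binary.Reasoning.Setoid setoid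

  ^-zeroˡ : ∀ n → 1# ^ n ≈ 1#
  ^-zeroˡ zero    = refl
  ^-zeroˡ (suc n) = trans (*-identityˡ _) (^-zeroˡ n)

  ×1≈0⇒×≈0 : ∀ n → n × 1# ≈ 0# → ∀ x → n × x ≈ 0#
  ×1≈0⇒×≈0 n n×1≈0 x = begin
    n × x          ≈⟨ ×-congʳ n (*-identityˡ x) ⟨
    n × (1# * x)   ≈⟨ ×-assoc-* n 1# x ⟨
    (n × 1#) * x   ≈⟨ *-congʳ n×1≈0 ⟩
    0# * x         ≈⟨ zeroˡ x ⟩
    0#             ∎

  ∣⇒×1≈0 : ∀ {p n} → p × 1# ≈ 0# → p ∣ n → n × 1# ≈ 0#
  ∣⇒×1≈0 {p} p×1≈0 (divides q ≡.refl) = begin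
    (q ℕ.* p) × 1#          ≈⟨ ×1-homo-* q p ⟩
    (q × 1#) * (p × 1#)     ≈⟨ *-congˡ p×1≈0 ⟩
    (q × 1#) * 0#           ≈⟨ zeroʳ _ ⟩
    0#                      ∎

  binomialTerm-first : ∀ x y n → binomialTerm x y n Fin.zero ≈ y ^ n
  binomialTerm-first x y n = trans (×-homo-1 _) (*-identityˡ _)

  binomialTerm-last : ∀ x y n → binomialTerm x y n (fromℕ n) ≈ x ^ n
  binomialTerm-last x y n rewrite toℕ-fromℕ n | nCn≡1 n | ℕ.n∸n≡0 n =
    trans (×-homo-1 _) (*-identityʳ _)

  inner-binomials≈0⇒^-distrib-+ : ∀ q → (∀ k → 0 ℕ.< k → k ℕ.< suc q → (suc q C k) × 1# ≈ 0#) →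
                                  ∀ x y → (x + y) ^ suc q ≈ x ^ suc q + y ^ suc q
  inner-binomials≈0⇒^-distrib-+ q inner≈0 x y = begin
    (x + y) ^ n                                          ≈⟨ theorem n x y ⟩
    term Fin.zero + sum (λ i → term (Fin.suc i))
      ≈⟨ +-cong (binomialTerm-first x y n) (sum-init-last (λ i → term (Fin.suc i))) ⟩
    y ^ n + (sum (λ i → term (Fin.suc (inject₁ i))) + term (fromℕ n))
      ≈⟨ +-congˡ (+-cong inner-sum≈0 (binomialTerm-last x y n)) ⟩
    y ^ n + (0# + x ^ n)                                 ≈⟨ +-congˡ (+-identityˡ _) ⟩
    y ^ n + x ^ n                                        ≈⟨ +-comm _ _ ⟩
    x ^ n + y ^ n                                        ∎
    where
    n = suc q
    term : Fin (suc n) → Carrier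
    term = binomialTerm x y n
    inner-sum≈0 : sum (λ (i : Fin q) → term (Fin.suc (inject₁ i))) ≈ 0#
    inner-sum≈0 = trans (sum-cong-≋ inner-term≈0) (sum-replicate-zero q)
      where
      inner-term≈0 : ∀ (i : Fin q) → term (Fin.suc (inject₁ i)) ≈ 0#
      inner-term≈0 i = ×1≈0⇒×≈0 (n C k) (inner≈0 k z<s (s<s (inject₁ℕ< i))) _
        where k = suc (toℕ (inject₁ i))

  -- No clause for p = 0: Prime 0 would carry an instance of the empty type NonTrivial 0.
  frobenius : ∀ {p} → Prime p → p × 1# ≈ 0# → ∀ x y → (x + y) ^ p ≈ x ^ p + y ^ p
  frobenius {suc q} p-prime p×1≈0 = inner-binomials≈0⇒^-distrib-+ q
    (λ k 0<k k<p → ∣⇒×1≈0 p×1≈0 (prime∣binomial p-prime 0<k k<p))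

  frobenius-^ : ∀ {p} → Prime p → p × 1# ≈ 0# →
                ∀ f x y → (x + y) ^ (p ℕ.^ f) ≈ x ^ (p ℕ.^ f) + y ^ (p ℕ.^ f)
  frobenius-^ p-prime p×1≈0 zero    x y = distribʳ 1# x y
  frobenius-^ {p} p-prime p×1≈0 (suc f) x y = begin
    (x + y) ^ (p ℕ.* p ℕ.^ f)               ≈⟨ ^-assocʳ (x + y) p (p ℕ.^ f) ⟨
    ((x + y) ^ p) ^ (p ℕ.^ f)               ≈⟨ ^-congˡ (p ℕ.^ f) (frobenius p-prime p×1≈0 x y) ⟩
    (x ^ p + y ^ p) ^ (p ℕ.^ f)             ≈⟨ frobenius-^ p-prime p×1≈0 f (x ^ p) (y ^ p) ⟩
    (x ^ p) ^ (p ℕ.^ f) + (y ^ p) ^ (p ℕ.^ f) ≈⟨ +-cong (^-assocʳ x p (p ℕ.^ f)) (^-assocʳ y p (p ℕ.^ f)) ⟩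
    x ^ (p ℕ.* p ℕ.^ f) + y ^ (p ℕ.* p ℕ.^ f) ∎

  ζ^d≈1⇒[ζ^i*u]^d≈u^d : ∀ {d ζ} → ζ ^ d ≈ 1# → ∀ i u → (ζ ^ i * u) ^ d ≈ u ^ d
  ζ^d≈1⇒[ζ^i*u]^d≈u^d {d} {ζ} ζ^d≈1 i u = begin
    (ζ ^ i * u) ^ d          ≈⟨ ^-distrib-* (ζ ^ i) u d ⟩
    (ζ ^ i) ^ d * u ^ d      ≈⟨ *-congʳ (^-assocʳ ζ i d) ⟩
    ζ ^ (i ℕ.* d) * u ^ d    ≡⟨ ≡.cong (λ e → ζ ^ e * u ^ d) (ℕ.*-comm i d) ⟩
    ζ ^ (d ℕ.* i) * u ^ d    ≈⟨ *-congʳ (^-assocʳ ζ d i) ⟨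
    (ζ ^ d) ^ i * u ^ d      ≈⟨ *-congʳ (trans (^-congˡ i ζ^d≈1) (^-zeroˡ i)) ⟩
    1# * u ^ d               ≈⟨ *-identityˡ _ ⟩
    u ^ d                    ∎

module WeierstrassPoint {c ℓ} (K : CommutativeRing c ℓ) where
  open import Data.Nat as ℕ using (suc)
  import Data.Nat.Properties as ℕ using (+-comm)
  open import Relation.Binary.PropositionalEquality as ≡ using (_≡_)

  open CommutativeRing K
  open import Algebra.Properties.CommutativeSemiring.Exp commutativeSemiring
  open import Algebra.Properties.CommutativeSemigroup *-commutativeSemigroup using (x∙yz≈y∙xz)
  open import Relation.Binary.Reasoning.Setoid setoid

  onCurve-halfPower : ∀ {q m X t} → m ℕ.* 2 ≡ q ℕ.+ 1 →
                      (X + 1#) ^ q ≈ X ^ q + 1# → X ^ (q ℕ.+ 1) ≈ t →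
                      OnCurve K t X (X * (X + 1#) ^ m)
  onCurve-halfPower {q} {m} {X} {t} m*2≡q+1 frob X^[q+1]≈t = begin
    (X * (X + 1#) ^ m) ^ 2                   ≈⟨ ^-distrib-* X ((X + 1#) ^ m) 2 ⟩
    X ^ 2 * ((X + 1#) ^ m) ^ 2               ≈⟨ *-congˡ (^-assocʳ (X + 1#) m 2) ⟩
    X ^ 2 * (X + 1#) ^ (m ℕ.* 2)             ≡⟨ ≡.cong (λ e → X ^ 2 * (X + 1#) ^ e) m*2≡1+q ⟩
    X ^ 2 * ((X + 1#) * (X + 1#) ^ q)        ≈⟨ *-congˡ (*-congˡ frob) ⟩
    (X * (X * 1#)) * ((X + 1#) * A)          ≈⟨ *-assoc X (X * 1#) _ ⟩
    X * ((X * 1#) * ((X + 1#) * A))          ≈⟨ *-congˡ (x∙yz≈y∙xz (X * 1#) (X + 1#) A) ⟩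
    X * ((X + 1#) * ((X * 1#) * A))
      ≈⟨ *-congˡ (*-congˡ (trans (*-congʳ (*-identityʳ X)) X*A≈X+t)) ⟩
    X * ((X + 1#) * (X + t))                 ∎
    where
    A = X ^ q + 1#
    q+1≡1+q : q ℕ.+ 1 ≡ suc q
    q+1≡1+q = ℕ.+-comm q 1
    m*2≡1+q : m ℕ.* 2 ≡ suc q
    m*2≡1+q = ≡.trans m*2≡q+1 q+1≡1+q
    X*A≈X+t : X * A ≈ X + t
    X*A≈X+t = begin
      X * (X ^ q + 1#)     ≈⟨ distribˡ X (X ^ q) 1# ⟩
      X ^ suc q + X * 1#   ≈⟨ +-cong (trans (^-congʳ X (≡.sym q+1≡1+q)) X^[q+1]≈t) (*-identityʳ X) ⟩
      t + X                ≈⟨ +-comm t X ⟩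
      X + t                ∎

open import Level using (Level)
open import Data.Nat using (ℕ; _^_; _+_; _<_; _/_)
open import Data.Nat.DivMod using (m/n*n≡m)
open import Data.Nat.Primality using (Prime)
open import Data.Product using (_,_)
open import Relation.Nullary using (¬_)
open import Relation.Binary.PropositionalEquality using (_≡_)
open PrimeArithmetic using (odd-prime⇒2∣p^n+1)

proposition5p1 : ∀ {c ℓ : Level} (p f : ℕ) → Prime p → ¬ (p ≡ 2) → 0 < f →
    (K : CommutativeRing c ℓ) → IsField K → HasCharacteristic K p →
    (ζ u : CommutativeRing.Carrier K) →
    IsPrimitiveRoot K (p ^ f + 1) ζ →
    (i : ℕ) → i < p ^ f + 1 →
    OnCurve K (tOf K (p ^ f + 1) u) (Pₓ K (p ^ f + 1) ζ u i) (Pᵧ K (p ^ f + 1) ζ u i)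
proposition5p1 p f p-prime p≢2 _ K _ char ζ u (ζ^d≈1 , _) i _ =
  onCurve-halfPower {m = (p ^ f + 1) / 2} (m/n*n≡m (odd-prime⇒2∣p^n+1 p-prime p≢2 f))
    (trans (frobenius-^ p-prime char f _ 1#) (+-congˡ (^-zeroˡ (p ^ f))))
    (ζ^d≈1⇒[ζ^i*u]^d≈u^d {p ^ f + 1} ζ^d≈1 i u)
  where
  open CommutativeRing K using (1#; trans; +-congˡ)
  open CommutativeSemiringPowers (CommutativeRing.commutativeSemiring K)
  open WeierstrassPoint K
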